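{- Let $D$ be the directed path with vertex set $\{1,2,3\}$ and arcs $1\to2\to3$. A strategy $\mathcal{R}$ for Rei in the semi-restricted $D$-game is optimal if and only if $\Pr(\mathcal{R}(\mathbf{r})=3)=1/2$ for every restriction vector $\mathbf{r}$ with $\{3\}\subsetneq\operatorname{supp}(\mathbf{r})$.
   Context: A digraph $D$ has a finite vertex set $V(D)$ and a set $E(D)$ of ordered pairs of distinct vertices (arcs), with at most one arc between any pair. $N^+(v)=\{u:vu\in E(D)\}$, $N^-(v)=\{u:uv\in E(D)\}$. A restriction vector is a vector $\mathbf{r}$ of nonnegative integers indexed by $V(D)$; $\operatorname{supp}(\mathbf{r})=\{v:\mathbf{r}_v>0\}$; $\delta_v$ is the indicator vector of $v$. Semi-restricted $D$-game with parameter $\mathbf{r}$: Rei and Norman play $\sum_u\mathbf{r}_u$ rounds; in each round both simultaneously choose a vertex, Rei being required to choose each $u$ exactly $\mathbf{r}_u$ times overall, Norman unrestricted. A strategy for Norman is a function $\mathcal{N}$ assigning to each restriction vector a random variable with values in $V(D)$; a strategy for Rei is a function $\mathcal{R}$ assigning to each $\mathbf{r}$ a random variable with values in $\operatorname{supp}(\mathbf{r})$ (choices independent across players and rounds). Norman's score is defined recursively: $0$ if $\mathbf{r}=0$; otherwise with $x=\mathcal{N}(\mathbf{r})$, $y=\mathcal{R}(\mathbf{r})$, Norman gains $+1$ if $y\in N^+(x)$, $-1$ if $y\in N^-(x)$, $0$ otherwise, and play continues from $\mathbf{r}-\delta_y$. $S_D(\mathbf{r};\mathcal{N},\mathcal{R})$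 is the expected score, $S_D(\mathbf{r};\mathcal{R})=\max_{\mathcal{N}}S_D(\mathbf{r};\mathcal{N},\mathcal{R})$, $S_D(\mathbf{r})=\min_{\mathcal{R}}S_D(\mathbf{r};\mathcal{R})$. A strategy $\mathcal{R}$ for Rei is optimal if $S_D(\mathbf{r};\mathcal{R})=S_D(\mathbf{r})$ for every restriction vector $\mathbf{r}$.
   Formalization: All strategies for Rei and Norman, including $\mathcal{R}$ itself and those over which the maximum and minimum defining optimality are taken, assign rational probabilities to the vertices. -}

module Defs where

open import Data.Nat using (ℕ; zero; suc; _∸_; _<_) renaming (_+_ to _+ℕ_)
open import Data.Fin using (Fin; zero; suc; _≟_)
open import Data.Bool using (Bool; true; false; if_then_else_)
open import Data.Rational using (ℚ; 0ℚ; 1ℚ; ½; _+_; _*_; -_; _≤_)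
open import Data.Product using (Σ; ∃; _×_; _,_)
open import Data.Sum using (_⊎_)
open import Relation.Nullary using (does)
open import Relation.Binary.PropositionalEquality using (_≡_)

record Digraph (n : ℕ) : Set where
  field
    arc        : Fin n → Fin n → Bool
    irreflexive : ∀ x → arc x x ≡ false
    antisym    : ∀ x y → arc x y ≡ true → arc y x ≡ false

open Digraph public

sumℚ : ∀ n → (Fin n → ℚ) → ℚ
sumℚ zero    f = 0ℚ
sumℚ (suc n) f = f zero + sumℚ n (λ i → f (suc i))

sumℕ : ∀ n → (Fin n → ℕ) → ℕ
sumℕ zero    f = 0
sumℕ (suc n) f = f zero +ℕ sumℕ n (λ i → f (suc i))

RVec : ℕ → Set
RVec n = Fin n → ℕ

total : ∀ {n} → RVec n → ℕ
total {n} r = sumℕ n r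

dec : ∀ {n} → RVec n → Fin n → RVec n
dec r y v = if does (v ≟ y) then r v ∸ 1 else r v

InSupp : ∀ {n} → RVec n → Fin n → Set
InSupp r v = 0 < r v

NonZeroR : ∀ {n} → RVec n → Set
NonZeroR r = ∃ λ v → InSupp r v

record NStrat (n : ℕ) : Set where
  field
    prob    : RVec n → Fin n → ℚ
    nonneg  : ∀ r v → 0ℚ ≤ prob r v
    sum-one : ∀ r → sumℚ n (prob r) ≡ 1ℚ

-- Rei's strategy: to each nonzero r a probability distribution on supp(r).
-- (At r = 0 the game is over; there prob is forced to be 0 by `supported`,
-- and it is never used.)
record RStrat (n : ℕ) : Set where
  field
    prob      : RVec n → Fin n → ℚ
    nonneg    : ∀ r v → 0ℚ ≤ prob r v
    supported : ∀ r v → r v ≡ 0 → prob r v ≡ 0ℚ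
    sum-one   : ∀ r → NonZeroR r → sumℚ n (prob r) ≡ 1ℚ

-- payoff to Norman when Norman picks x and Rei picks y
payoff : ∀ {n} → Digraph n → Fin n → Fin n → ℚ
payoff D x y =
  if arc D x y then 1ℚ else (if arc D y x then - 1ℚ else 0ℚ)

-- expected score with fuel k (the game from r lasts exactly total r rounds)
scoreF : ∀ {n} → Digraph n → NStrat n → RStrat n → ℕ → RVec n → ℚ
scoreF D N R zero    r = 0ℚ
scoreF {n} D N R (suc k) r =
  sumℚ n (λ x → sumℚ n (λ y →
    NStrat.prob N r x * RStrat.prob R r y
      * (payoff D x y + scoreF D N R k (dec r y))))

score : ∀ {n} → Digraph n → RVec n → NStrat n → RStrat n → ℚ
score D r N R = scoreF D N R (total r) r

IsScoreR : ∀ {n} → Digraph n → RVec n → RStrat n → ℚ → Set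
IsScoreR {n} D r R v =
  (∀ (N : NStrat n) → score D r N R ≤ v) × (∃ λ (N : NStrat n) → score D r N R ≡ v)

IsValue : ∀ {n} → Digraph n → RVec n → ℚ → Set
IsValue {n} D r v =
  (∀ (R : RStrat n) w → IsScoreR D r R w → v ≤ w) × (∃ λ (R : RStrat n) → IsScoreR D r R v)

Optimal : ∀ {n} → Digraph n → RStrat n → Set
Optimal D R = ∀ r → ∃ λ v → IsScoreR D r R v × IsValue D r v

-- The directed path 1 → 2 → 3, with vertices 1,2,3 encoded as Fin 3 elements 0,1,2.
pathArc : Fin 3 → Fin 3 → Bool
pathArc zero (suc zero) = true
pathArc (suc zero) (suc (suc zero)) = true
pathArc _ _ = false

P3 : Digraph 3
P3 = record { arc = pathArc ; irreflexive = irr ; antisym = anti }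
  where
  irr : ∀ x → pathArc x x ≡ false
  irr zero = _≡_.refl
  irr (suc zero) = _≡_.refl
  irr (suc (suc zero)) = _≡_.refl
  anti : ∀ x y → pathArc x y ≡ true → pathArc y x ≡ false
  anti zero (suc zero) _ = _≡_.refl
  anti (suc zero) (suc (suc zero)) _ = _≡_.refl

v1 v2 v3 : Fin 3
v1 = zero
v2 = suc zero
v3 = suc (suc zero)

ThreeStrictSupp : RVec 3 → Set
ThreeStrictSupp r = InSupp r v3 × (InSupp r v1 ⊎ InSupp r v2)

-- Write r = (a, b, c) and n = a + b. The value of the game is V r = b + G n c, where
-- G = value₁₃ has G n 0 = 0, G 0 c = c, and otherwise G n c is the average of G (n − 1) c
-- and G n (c − 1). With the gap γ = G (n − 1) c − G n (c − 1), Norman's lookahead (payoff of the round plus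
-- V of the next state) against Rei's distribution p is V + (½ − p₃) γ when he plays 1 and
-- V + (p₃ − ½) (2 − γ) when he plays 2, and playing 3 is dominated by playing 1. The gap
-- is harmonic in the interior with boundary values 0 and 2, so 0 < γ < 2 exactly when
-- {3} ⊊ supp r. Hence a Rei who plays 3 with probability ½ at such r holds every Norman to V,
-- while against any other Rei, Norman's best response secures V everywhere and strictly more
-- at an r where p₃ ≠ ½.

{-# OPTIONS --safe #-}
module Submission where

open import Defs
open import Data.Rational using (½)
open import Function.Bundles using (_⇔_)
open import Relation.Binary.PropositionalEquality using (_≡_)

open import Data.Nat.Base using (ℕ; zero; suc; _∸_; s≤s; z≤n) renaming (_+_ to _+ℕ_; _<_ to _<ℕ_)
import Data.Nat.Properties as ℕ
open import Data.Fin.Base using (Fin; zero; suc)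
open import Data.Vec.Functional using ([]; _∷_)
open import Data.Vec.Functional.Relation.Unary.All using (All; all)
open import Data.Rational using (ℚ; 0ℚ; 1ℚ; _+_; _*_; -_; _-_; _≤_; _<_; nonNegative; positive)
import Data.Rational.Properties as ℚ
open import Data.Rational.Solver using (module +-*-Solver)
open +-*-Solver using (solve; _:=_; con; _:+_; _:*_; _:-_)
open import Data.Product using (_×_; _,_; proj₁; proj₂; Σ; map)
open import Data.Sum using (_⊎_; inj₁; inj₂; [_,_]′; map₂)
open import Data.Unit using (tt)
open import Function.Base using (_∘_)
open import Function.Bundles using (mk⇔)
open import Function.Construct.Composition using (_⇔-∘_)
open import Relation.Binary.Definitions using (tri<; tri≈; tri>)
open import Relation.Binary.PropositionalEquality
  using (_≢_; refl; sym; trans; cong; cong₂; subst; subst₂; module ≡-Reasoning)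
open import Relation.Nullary using (Dec; yes; no; contradiction)
open import Relation.Nullary.Decidable using (True; toWitness; decidable-stable)

p≤q⇒0≤q-p : ∀ {p q} → p ≤ q → 0ℚ ≤ q - p
p≤q⇒0≤q-p {p} {q} p≤q = subst (_≤ q - p) (ℚ.+-inverseʳ p) (ℚ.+-monoˡ-≤ (- p) p≤q)

p<q⇒0<q-p : ∀ {p q} → p < q → 0ℚ < q - p
p<q⇒0<q-p {p} {q} p<q = subst (_< q - p) (ℚ.+-inverseʳ p) (ℚ.+-monoˡ-< (- p) p<q)

p≤p+q : ∀ p {q} → 0ℚ ≤ q → p ≤ p + q
p≤p+q p {q} 0≤q = subst (_≤ p + q) (ℚ.+-identityʳ p) (ℚ.+-monoʳ-≤ p 0≤q)

p<p+q : ∀ p {q} → 0ℚ < q → p < p + q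
p<p+q p {q} 0<q = subst (_< p + q) (ℚ.+-identityʳ p) (ℚ.+-monoʳ-< p 0<q)

p+q≤p : ∀ p {q} → q ≤ 0ℚ → p + q ≤ p
p+q≤p p {q} q≤0 = subst (p + q ≤_) (ℚ.+-identityʳ p) (ℚ.+-monoʳ-≤ p q≤0)

*-nonNeg : ∀ {p q} → 0ℚ ≤ p → 0ℚ ≤ q → 0ℚ ≤ p * q
*-nonNeg {p} {q} 0≤p 0≤q =
  ℚ.nonNegative⁻¹ (p * q) {{ℚ.nonNeg*nonNeg⇒nonNeg p {{nonNegative 0≤p}} q {{nonNegative 0≤q}}}}

*-pos : ∀ {p q} → 0ℚ < p → 0ℚ < q → 0ℚ < p * q
*-pos {p} {q} 0<p 0<q = ℚ.positive⁻¹ (p * q) {{ℚ.pos*pos⇒pos p {{positive 0<p}} q {{positive 0<q}}}}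

≤∧≢⇒< : ∀ {p q} → p ≤ q → p ≢ q → p < q
≤∧≢⇒< {p} {q} p≤q p≢q with ℚ.<-cmp p q
... | tri< p<q _ _ = p<q
... | tri≈ _ p≡q _ = contradiction p≡q p≢q
... | tri> _ _ q<p = contradiction (ℚ.<-≤-trans q<p p≤q) (ℚ.<-irrefl refl)

2ℚ : ℚ
2ℚ = 1ℚ + 1ℚ

average-in-band : ∀ {x y} → 0ℚ < x × x < 2ℚ → 0ℚ ≤ y × y ≤ 2ℚ →
                  0ℚ < ½ * (x + y) × ½ * (x + y) < 2ℚ
average-in-band (0<x , x<2) (0≤y , y≤2) =
  ℚ.*-monoʳ-<-pos ½ (ℚ.+-mono-<-≤ 0<x 0≤y) , ℚ.*-monoʳ-<-pos ½ (ℚ.+-mono-<-≤ x<2 y≤2)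

sumℚ-cong : ∀ n {f g : Fin n → ℚ} → (∀ i → f i ≡ g i) → sumℚ n f ≡ sumℚ n g
sumℚ-cong zero    f≡g = refl
sumℚ-cong (suc n) f≡g = cong₂ _+_ (f≡g zero) (sumℚ-cong n (f≡g ∘ suc))

sumℚ-mono : ∀ n {f g : Fin n → ℚ} → (∀ i → f i ≤ g i) → sumℚ n f ≤ sumℚ n g
sumℚ-mono zero    f≤g = ℚ.≤-refl
sumℚ-mono (suc n) f≤g = ℚ.+-mono-≤ (f≤g zero) (sumℚ-mono n (f≤g ∘ suc))

sumℚ-*ˡ : ∀ n c (f : Fin n → ℚ) → sumℚ n (λ i → c * f i) ≡ c * sumℚ n f
sumℚ-*ˡ zero    c f = sym (ℚ.*-zeroʳ c)
sumℚ-*ˡ (suc n) c f = trans (cong (c * f zero +_) (sumℚ-*ˡ n c (f ∘ suc)))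
                            (sym (ℚ.*-distribˡ-+ c (f zero) (sumℚ n (f ∘ suc))))

sumℚ-*ʳ : ∀ n c (f : Fin n → ℚ) → sumℚ n (λ i → f i * c) ≡ sumℚ n f * c
sumℚ-*ʳ n c f = trans (sumℚ-cong n (λ i → ℚ.*-comm (f i) c)) (trans (sumℚ-*ˡ n c f) (ℚ.*-comm c _))

sumℚ-weighted-mono : ∀ n {w f g : Fin n → ℚ} → (∀ i → 0ℚ ≤ w i) → (∀ i → w i ≡ 0ℚ ⊎ f i ≤ g i) →
                     sumℚ n (λ i → w i * f i) ≤ sumℚ n (λ i → w i * g i)
sumℚ-weighted-mono n {w} {f} {g} 0≤w f≤g = sumℚ-mono n λ i →
  [ zero-weight (f i) (g i) , ℚ.*-monoˡ-≤-nonNeg (w i) {{nonNegative (0≤w i)}} ]′ (f≤g i)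
  where
  zero-weight : ∀ {c} a b → c ≡ 0ℚ → c * a ≤ c * b
  zero-weight a b refl = ℚ.≤-reflexive (trans (ℚ.*-zeroˡ a) (sym (ℚ.*-zeroˡ b)))

pointMass : ∀ {n} → Fin n → Fin n → ℚ
pointMass zero    zero    = 1ℚ
pointMass zero    (suc _) = 0ℚ
pointMass (suc _) zero    = 0ℚ
pointMass (suc i) (suc j) = pointMass i j

pointMass-nonNeg : ∀ {n} (i j : Fin n) → 0ℚ ≤ pointMass i j
pointMass-nonNeg zero    zero    = ℚ.<⇒≤ (ℚ.positive⁻¹ 1ℚ)
pointMass-nonNeg zero    (suc _) = ℚ.≤-refl
pointMass-nonNeg (suc _) zero    = ℚ.≤-refl
pointMass-nonNeg (suc i) (suc j) = pointMass-nonNeg i j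

sumℚ-pointMass : ∀ n i (f : Fin n → ℚ) → sumℚ n (λ j → pointMass i j * f j) ≡ f i
sumℚ-pointMass (suc n) zero f = begin
  1ℚ * f zero + sumℚ n (λ j → 0ℚ * f (suc j))
    ≡⟨ cong₂ _+_ (ℚ.*-identityˡ (f zero)) (sumℚ-*ˡ n 0ℚ (f ∘ suc)) ⟩
  f zero + 0ℚ * sumℚ n (f ∘ suc)
    ≡⟨ cong (f zero +_) (ℚ.*-zeroˡ (sumℚ n (f ∘ suc))) ⟩
  f zero + 0ℚ
    ≡⟨ ℚ.+-identityʳ (f zero) ⟩
  f zero ∎
  where open ≡-Reasoning
sumℚ-pointMass (suc n) (suc i) f =
  trans (cong (_+ sumℚ n (λ j → pointMass i j * f (suc j))) (ℚ.*-zeroˡ (f zero)))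
        (trans (ℚ.+-identityˡ _) (sumℚ-pointMass n i (f ∘ suc)))

sumℚ-pointMass≡1 : ∀ n (i : Fin n) → sumℚ n (pointMass i) ≡ 1ℚ
sumℚ-pointMass≡1 n i =
  trans (sumℚ-cong n (λ j → sym (ℚ.*-identityʳ (pointMass i j)))) (sumℚ-pointMass n i (λ _ → 1ℚ))

-- Bounding scores by one-round lookahead

total-dec : ∀ {n} (r : RVec n) {y} → InSupp r y → total r ≡ suc (total (dec r y))
total-dec {suc n} r {zero}  0<r₀ = cong (_+ℕ total (r ∘ suc)) (sym (ℕ.m+[n∸m]≡n 0<r₀))
total-dec {suc n} r {suc y} 0<rᵧ =
  trans (cong (r zero +ℕ_) (total-dec (r ∘ suc) 0<rᵧ)) (ℕ.+-suc (r zero) _)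

total≡suc⇒nonZero : ∀ {n} (r : RVec n) {k} → total r ≡ suc k → NonZeroR r
total≡suc⇒nonZero {suc n} r t with r zero ℕ.≟ 0
... | no  r₀≢0 = zero , ℕ.n≢0⇒n>0 r₀≢0
... | yes r₀≡0 with total≡suc⇒nonZero (r ∘ suc) (trans (cong (_+ℕ total (r ∘ suc)) (sym r₀≡0)) t)
...   | v , 0<rᵥ = suc v , 0<rᵥ

module _ {n} (R : RStrat n) where
  open RStrat R

  prob≡0⊎InSupp : ∀ r y → prob r y ≡ 0ℚ ⊎ InSupp r y
  prob≡0⊎InSupp r y with r y ℕ.≟ 0
  ... | yes r≡0 = inj₁ (supported r y r≡0)
  ... | no  r≢0 = inj₂ (ℕ.n≢0⇒n>0 r≢0)

payoffAgainst : ∀ {n} → Digraph n → (Fin n → ℚ) → (Fin n → ℚ) → Fin n → ℚ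
payoffAgainst {n} D p w x = sumℚ n (λ y → p y * (payoff D x y + w y))

payoffAgainst-dominated : ∀ {n} (D : Digraph n) {p} (w : Fin n → ℚ) {x x′} → (∀ y → 0ℚ ≤ p y) →
                          (∀ y → payoff D x′ y ≤ payoff D x y) →
                          payoffAgainst D p w x′ ≤ payoffAgainst D p w x
payoffAgainst-dominated {n} D w 0≤p x′≤x =
  sumℚ-weighted-mono n 0≤p (λ y → inj₂ (ℚ.+-monoˡ-≤ (w y) (x′≤x y)))

pure : ∀ {n} → (RVec n → Fin n) → NStrat n
pure {n} σ = record
  { prob    = pointMass ∘ σ
  ; nonneg  = pointMass-nonNeg ∘ σ
  ; sum-one = sumℚ-pointMass≡1 n ∘ σ
  }

module _ {n} (D : Digraph n) (R : RStrat n) where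
  open RStrat R

  lookahead : (RVec n → ℚ) → RVec n → Fin n → ℚ
  lookahead W r = payoffAgainst D (prob r) (W ∘ dec r)

  payoffAgainst-supp-mono : ∀ r {w w′ : Fin n → ℚ} → (∀ y → InSupp r y → w y ≤ w′ y) →
                            ∀ x → payoffAgainst D (prob r) w x ≤ payoffAgainst D (prob r) w′ x
  payoffAgainst-supp-mono r w≤w′ x = sumℚ-weighted-mono n (nonneg r)
    (λ y → map₂ (ℚ.+-monoʳ-≤ (payoff D x y) ∘ w≤w′ y) (prob≡0⊎InSupp R r y))

  payoffAgainst-supp-cong : ∀ r {w w′ : Fin n → ℚ} → (∀ y → InSupp r y → w y ≡ w′ y) →
                            ∀ x → payoffAgainst D (prob r) w x ≡ payoffAgainst D (prob r) w′ x
  payoffAgainst-supp-cong r w≡w′ x = ℚ.≤-antisym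
    (payoffAgainst-supp-mono r (λ y → ℚ.≤-reflexive ∘ w≡w′ y) x)
    (payoffAgainst-supp-mono r (λ y → ℚ.≤-reflexive ∘ sym ∘ w≡w′ y) x)

  scoreF-suc : ∀ N k r → scoreF D N R (suc k) r ≡
               sumℚ n (λ x → NStrat.prob N r x * lookahead (scoreF D N R k) r x)
  scoreF-suc N k r = sumℚ-cong n λ x →
    trans (sumℚ-cong n λ y → ℚ.*-assoc (NStrat.prob N r x) (prob r y) (continuation x y))
          (sumℚ-*ˡ n (NStrat.prob N r x) λ y → prob r y * continuation x y)
    where
    continuation : Fin n → Fin n → ℚ
    continuation x y = payoff D x y + scoreF D N R k (dec r y)

  scoreF-pure : ∀ σ k r →
                scoreF D (pure σ) R (suc k) r ≡ lookahead (scoreF D (pure σ) R k) r (σ r)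
  scoreF-pure σ k r = trans (scoreF-suc (pure σ) k r) (sumℚ-pointMass n (σ r) _)

  module _ (W : RVec n → ℚ) (W-empty : ∀ r → total r ≡ 0 → W r ≡ 0ℚ) where

    private
      total-after : ∀ {k} (r : RVec n) → total r ≡ suc k → ∀ y → InSupp r y → total (dec r y) ≡ k
      total-after r t y 0<rᵧ = ℕ.suc-injective (trans (sym (total-dec r 0<rᵧ)) t)

    score≤ : (∀ r x → NonZeroR r → lookahead W r x ≤ W r) →
             ∀ N r → score D r N R ≤ W r
    score≤ step N r = go (total r) r refl
      where
      go : ∀ k r → total r ≡ k → scoreF D N R k r ≤ W r
      go zero    r t = ℚ.≤-reflexive (sym (W-empty r t))
      go (suc k) r t = begin
        scoreF D N R (suc k) r
          ≡⟨ scoreF-suc N k r ⟩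
        sumℚ n (λ x → ν x * lookahead (scoreF D N R k) r x)
          ≤⟨ sumℚ-mono n (λ x → ℚ.*-monoˡ-≤-nonNeg (ν x) {{nonNegative (NStrat.nonneg N r x)}} (bound x)) ⟩
        sumℚ n (λ x → ν x * W r)
          ≡⟨ sumℚ-*ʳ n (W r) ν ⟩
        sumℚ n ν * W r
          ≡⟨ cong (_* W r) (NStrat.sum-one N r) ⟩
        1ℚ * W r
          ≡⟨ ℚ.*-identityˡ (W r) ⟩
        W r ∎
        where
        open ℚ.≤-Reasoning
        ν = NStrat.prob N r
        bound : ∀ x → lookahead (scoreF D N R k) r x ≤ W r
        bound x = ℚ.≤-trans
          (payoffAgainst-supp-mono r (λ y s → go k (dec r y) (total-after r t y s)) x)
          (step r x (total≡suc⇒nonZero r t))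

    module _ (σ : RVec n → Fin n)
             (step : ∀ r → NonZeroR r → W r ≤ lookahead W r (σ r)) where

      private
        W≤scoreF-pure : ∀ k r → total r ≡ k → W r ≤ scoreF D (pure σ) R k r
        lookahead≤scoreF-pure : ∀ k r → total r ≡ suc k →
                                lookahead W r (σ r) ≤ scoreF D (pure σ) R (suc k) r

        W≤scoreF-pure zero    r t = ℚ.≤-reflexive (W-empty r t)
        W≤scoreF-pure (suc k) r t =
          ℚ.≤-trans (step r (total≡suc⇒nonZero r t)) (lookahead≤scoreF-pure k r t)

        lookahead≤scoreF-pure k r t = ℚ.≤-trans
          (payoffAgainst-supp-mono r (λ y s → W≤scoreF-pure k (dec r y) (total-after r t y s)) (σ r))
          (ℚ.≤-reflexive (sym (scoreF-pure σ k r)))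

      W≤score-pure : ∀ r → W r ≤ score D r (pure σ) R
      W≤score-pure r = W≤scoreF-pure (total r) r refl

      W<score-pure : ∀ r → NonZeroR r → W r < lookahead W r (σ r) →
                     W r < score D r (pure σ) R
      W<score-pure r (y , 0<rᵧ) W<Q =
        subst (λ k → W r < scoreF D (pure σ) R k r) (sym (total-dec r 0<rᵧ))
              (ℚ.<-≤-trans W<Q (lookahead≤scoreF-pure _ r (total-dec r 0<rᵧ)))

-- Values and optimal strategies

module _ {n} (D : Digraph n) where

  isScoreR-intro : ∀ {r R v} → (∀ N → score D r N R ≤ v) → ∀ N → v ≤ score D r N R → IsScoreR D r R v
  isScoreR-intro upper N lower = upper , N , ℚ.≤-antisym (upper N) lower

  isValue-intro : ∀ {r v} → (∀ R → Σ (NStrat n) λ N → v ≤ score D r N R) →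
                  ∀ R → IsScoreR D r R v → IsValue D r v
  isValue-intro secured R attained =
    (λ R′ w (upper , _) → let N , v≤ = secured R′ in ℚ.≤-trans v≤ (upper N)) , R , attained

  isValue-unique : ∀ {r v w} → IsValue D r v → IsValue D r w → v ≡ w
  isValue-unique (v-least , R , v-attained) (w-least , R′ , w-attained) =
    ℚ.≤-antisym (v-least R′ _ w-attained) (w-least R _ v-attained)

  optimal⇔attains : ∀ {W : RVec n → ℚ} → (∀ r → IsValue D r (W r)) →
                    ∀ R → Optimal D R ⇔ (∀ r → IsScoreR D r R (W r))
  optimal⇔attains {W} isValue R = mk⇔ scores (λ attained r → W r , attained r , isValue r)
    where
    scores : Optimal D R → ∀ r → IsScoreR D r R (W r)
    scores opt r with opt r
    ... | v , v-score , v-value = subst (IsScoreR D r R) (isValue-unique v-value (isValue r)) v-score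

-- The directed path 1 → 2 → 3

ofℕ : ℕ → ℚ
ofℕ zero    = 0ℚ
ofℕ (suc n) = 1ℚ + ofℕ n

value₁₃ : ℕ → ℕ → ℚ
value₁₃ n       zero    = 0ℚ
value₁₃ zero    (suc c) = ofℕ (suc c)
value₁₃ (suc n) (suc c) = ½ * (value₁₃ n (suc c) + value₁₃ (suc n) c)

-- On the boundary, where Rei's move is forced, gap takes the value that makes the
-- lookahead formulas hold there as well.
gap : ℕ → ℕ → ℚ
gap n       zero    = 0ℚ
gap zero    (suc c) = 2ℚ
gap (suc n) (suc c) = value₁₃ n (suc c) - value₁₃ (suc n) c

value₁₃-pred₁ : ∀ n c → value₁₃ n c ≡ value₁₃ (suc n) c + ½ * gap (suc n) c
value₁₃-pred₁ n zero    = refl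
value₁₃-pred₁ n (suc c) = solve 2 (λ X Y → X := con ½ :* (X :+ Y) :+ con ½ :* (X :- Y)) refl
  (value₁₃ n (suc c)) (value₁₃ (suc n) c)

value₁₃-pred₃ : ∀ n c → value₁₃ n c ≡ value₁₃ n (suc c) - ½ * gap n (suc c)
value₁₃-pred₃ zero    zero    = refl
value₁₃-pred₃ zero    (suc c) =
  solve 1 (λ z → con 1ℚ :+ z := (con 1ℚ :+ (con 1ℚ :+ z)) :- con ½ :* (con 1ℚ :+ con 1ℚ)) refl (ofℕ c)
value₁₃-pred₃ (suc n) c       = solve 2 (λ X Y → Y := con ½ :* (X :+ Y) :- con ½ :* (X :- Y)) refl
  (value₁₃ n (suc c)) (value₁₃ (suc n) c)

gap-harmonic : ∀ n c → gap (suc n) (suc c) ≡ ½ * (gap n (suc c) + gap (suc n) c)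
gap-harmonic zero    zero    = refl
gap-harmonic (suc n) zero    =
  solve 1 (λ X → con ½ :* (X :+ con 0ℚ) :- con 0ℚ := con ½ :* ((X :- con 0ℚ) :+ con 0ℚ)) refl (value₁₃ n 1)
gap-harmonic zero    (suc c) =
  solve 2 (λ z Y → (con 1ℚ :+ (con 1ℚ :+ z)) :- con ½ :* ((con 1ℚ :+ z) :+ Y)
                   := con ½ :* ((con 1ℚ :+ con 1ℚ) :+ ((con 1ℚ :+ z) :- Y))) refl
    (ofℕ c) (value₁₃ 1 c)
gap-harmonic (suc n) (suc c) =
  solve 3 (λ A B C → con ½ :* (C :+ A) :- con ½ :* (A :+ B) := con ½ :* ((C :- A) :+ (A :- B))) refl
    (value₁₃ (suc n) (suc c)) (value₁₃ (suc (suc n)) c) (value₁₃ n (suc (suc c)))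

gap-interior : ∀ n c → 0ℚ < gap (suc n) (suc c) × gap (suc n) (suc c) < 2ℚ
gap-interior zero    zero    = ℚ.positive⁻¹ 1ℚ , p<p+q 1ℚ (ℚ.positive⁻¹ 1ℚ)
gap-interior (suc n) zero    = subst (λ g → 0ℚ < g × g < 2ℚ) (sym (gap-harmonic (suc n) zero))
  (average-in-band (gap-interior n zero) (ℚ.≤-refl , ℚ.≤ᵇ⇒≤ tt))
gap-interior zero    (suc c) = subst (λ g → 0ℚ < g × g < 2ℚ)
  (sym (trans (gap-harmonic zero (suc c)) (cong (½ *_) (ℚ.+-comm 2ℚ (gap 1 (suc c))))))
  (average-in-band (gap-interior zero c) (ℚ.≤ᵇ⇒≤ tt , ℚ.≤-refl))
gap-interior (suc n) (suc c) = subst (λ g → 0ℚ < g × g < 2ℚ) (sym (gap-harmonic (suc n) (suc c)))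
  (average-in-band (gap-interior n (suc c)) (map ℚ.<⇒≤ ℚ.<⇒≤ (gap-interior (suc n) c)))

gap-bounds : ∀ n c → 0ℚ ≤ gap n c × gap n c ≤ 2ℚ
gap-bounds n       zero    = ℚ.≤-refl , ℚ.≤ᵇ⇒≤ tt
gap-bounds zero    (suc c) = ℚ.≤ᵇ⇒≤ tt , ℚ.≤-refl
gap-bounds (suc n) (suc c) = map ℚ.<⇒≤ ℚ.<⇒≤ (gap-interior n c)

gap-strict : ∀ {a b c} → 0 <ℕ c → 0 <ℕ a ⊎ 0 <ℕ b → 0ℚ < gap (a +ℕ b) c × gap (a +ℕ b) c < 2ℚ
gap-strict {suc a} {b}     {suc c} _ _         = gap-interior (a +ℕ b) c
gap-strict {zero}  {suc b} {suc c} _ _         = gap-interior b c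
gap-strict {zero}  {zero}  {suc c} _ (inj₁ ())
gap-strict {zero}  {zero}  {suc c} _ (inj₂ ())

gap-no₃ : ∀ {n c} → c ≡ 0 → gap n c ≡ 0ℚ
gap-no₃ refl = refl

gap-only₃ : ∀ {a b c} → a ≡ 0 → b ≡ 0 → 0 <ℕ c → gap (a +ℕ b) c ≡ 2ℚ
gap-only₃ refl refl (s≤s z≤n) = refl

valueAt : ℕ → ℕ → ℕ → ℚ
valueAt a b c = ofℕ b + value₁₃ (a +ℕ b) c

valueAt-pred₁ : ∀ {a} b c → 0 <ℕ a → valueAt (a ∸ 1) b c ≡ valueAt a b c + ½ * gap (a +ℕ b) c
valueAt-pred₁ {suc a} b c _ =
  trans (cong (ofℕ b +_) (value₁₃-pred₁ (a +ℕ b) c)) (sym (ℚ.+-assoc (ofℕ b) _ _))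

valueAt-pred₂ : ∀ a {b} c → 0 <ℕ b → valueAt a (b ∸ 1) c ≡ valueAt a b c + ½ * gap (a +ℕ b) c - 1ℚ
valueAt-pred₂ a {suc b} c _ = begin
  ofℕ b + value₁₃ (a +ℕ b) c
    ≡⟨ cong (ofℕ b +_) (value₁₃-pred₁ (a +ℕ b) c) ⟩
  ofℕ b + (value₁₃ (suc (a +ℕ b)) c + ½ * gap (suc (a +ℕ b)) c)
    ≡⟨ solve 3 (λ B X G → B :+ (X :+ con ½ :* G) := (con 1ℚ :+ B) :+ X :+ con ½ :* G :- con 1ℚ) refl
         (ofℕ b) (value₁₃ (suc (a +ℕ b)) c) (gap (suc (a +ℕ b)) c) ⟩
  ofℕ (suc b) + value₁₃ (suc (a +ℕ b)) c + ½ * gap (suc (a +ℕ b)) c - 1ℚ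
    ≡⟨ cong (λ m → ofℕ (suc b) + value₁₃ m c + ½ * gap m c - 1ℚ) (sym (ℕ.+-suc a b)) ⟩
  valueAt a (suc b) c + ½ * gap (a +ℕ suc b) c - 1ℚ ∎
  where open ≡-Reasoning

valueAt-pred₃ : ∀ a b {c} → 0 <ℕ c → valueAt a b (c ∸ 1) ≡ valueAt a b c - ½ * gap (a +ℕ b) c
valueAt-pred₃ a b {suc c} _ =
  trans (cong (ofℕ b +_) (value₁₃-pred₃ (a +ℕ b) c)) (sym (ℚ.+-assoc (ofℕ b) _ _))

value : RVec 3 → ℚ
value r = valueAt (r v1) (r v2) (r v3)

gapAt : RVec 3 → ℚ
gapAt r = gap (r v1 +ℕ r v2) (r v3)

value-empty : ∀ r → total r ≡ 0 → value r ≡ 0ℚ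
value-empty r = valueAt-empty (r v1) (r v2) (r v3)
  where
  valueAt-empty : ∀ a b c → a +ℕ (b +ℕ (c +ℕ 0)) ≡ 0 → valueAt a b c ≡ 0ℚ
  valueAt-empty zero zero zero refl = refl

localContinuation : ℚ → ℚ → Fin 3 → ℚ
localContinuation V γ = (V + ½ * γ) ∷ (V + ½ * γ - 1ℚ) ∷ (V - ½ * γ) ∷ []

value∘dec : ∀ r y → InSupp r y → value (dec r y) ≡ localContinuation (value r) (gapAt r) y
value∘dec r zero             = valueAt-pred₁ (r v2) (r v3)
value∘dec r (suc zero)       = valueAt-pred₂ (r v1) (r v3)
value∘dec r (suc (suc zero)) = valueAt-pred₃ (r v1) (r v2)

p₁≡1-p₂-p₃ : ∀ (p : Fin 3 → ℚ) → sumℚ 3 p ≡ 1ℚ → p v1 ≡ 1ℚ - (p v2 + p v3)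
p₁≡1-p₂-p₃ p Σp≡1 = trans
  (solve 3 (λ p₁ p₂ p₃ → p₁ := (p₁ :+ (p₂ :+ (p₃ :+ con 0ℚ))) :- (p₂ :+ p₃)) refl (p v1) (p v2) (p v3))
  (cong (_- (p v2 + p v3)) Σp≡1)

payoff₁-local : ∀ (p : Fin 3 → ℚ) V γ → sumℚ 3 p ≡ 1ℚ →
                payoffAgainst P3 p (localContinuation V γ) v1 ≡ V + (½ - p v3) * γ
payoff₁-local p V γ Σp≡1 = identity (p v1) (p v2) (p v3) (p₁≡1-p₂-p₃ p Σp≡1)
  where
  identity : ∀ p₁ p₂ p₃ → p₁ ≡ 1ℚ - (p₂ + p₃) →
             p₁ * (0ℚ + (V + ½ * γ)) + (p₂ * (1ℚ + (V + ½ * γ - 1ℚ)) + (p₃ * (0ℚ + (V - ½ * γ)) + 0ℚ))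
               ≡ V + (½ - p₃) * γ
  identity _ p₂ p₃ refl = solve 4 (λ p₂ p₃ V γ →
      (con 1ℚ :- (p₂ :+ p₃)) :* (con 0ℚ :+ (V :+ con ½ :* γ))
        :+ (p₂ :* (con 1ℚ :+ (V :+ con ½ :* γ :- con 1ℚ)) :+ (p₃ :* (con 0ℚ :+ (V :- con ½ :* γ)) :+ con 0ℚ))
      := V :+ (con ½ :- p₃) :* γ) refl p₂ p₃ V γ

payoff₂-local : ∀ (p : Fin 3 → ℚ) V γ → sumℚ 3 p ≡ 1ℚ →
                payoffAgainst P3 p (localContinuation V γ) v2 ≡ V + (p v3 - ½) * (2ℚ - γ)
payoff₂-local p V γ Σp≡1 = identity (p v1) (p v2) (p v3) (p₁≡1-p₂-p₃ p Σp≡1)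
  where
  identity : ∀ p₁ p₂ p₃ → p₁ ≡ 1ℚ - (p₂ + p₃) →
             p₁ * (- 1ℚ + (V + ½ * γ)) + (p₂ * (0ℚ + (V + ½ * γ - 1ℚ)) + (p₃ * (1ℚ + (V - ½ * γ)) + 0ℚ))
               ≡ V + (p₃ - ½) * (2ℚ - γ)
  identity _ p₂ p₃ refl = solve 4 (λ p₂ p₃ V γ →
      (con 1ℚ :- (p₂ :+ p₃)) :* (con (- 1ℚ) :+ (V :+ con ½ :* γ))
        :+ (p₂ :* (con 0ℚ :+ (V :+ con ½ :* γ :- con 1ℚ)) :+ (p₃ :* (con 1ℚ :+ (V :- con ½ :* γ)) :+ con 0ℚ))
      := V :+ (p₃ :- con ½) :* ((con 1ℚ :+ con 1ℚ) :- γ)) refl p₂ p₃ V γ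

v1-dominates-v3 : ∀ y → payoff P3 v3 y ≤ payoff P3 v1 y
v1-dominates-v3 zero             = ℚ.≤-refl
v1-dominates-v3 (suc zero)       = ℚ.≤ᵇ⇒≤ tt
v1-dominates-v3 (suc (suc zero)) = ℚ.≤-refl

Unexploitable : ℚ → ℚ → Set
Unexploitable p₃ γ = (½ - p₃) * γ ≤ 0ℚ × (p₃ - ½) * (2ℚ - γ) ≤ 0ℚ

unexploitable-½ : ∀ γ → Unexploitable ½ γ
unexploitable-½ γ = ℚ.≤-reflexive (ℚ.*-zeroˡ γ) , ℚ.≤-reflexive (ℚ.*-zeroˡ (2ℚ - γ))

unexploitable-0 : Unexploitable 0ℚ 0ℚ
unexploitable-0 = ℚ.≤ᵇ⇒≤ tt , ℚ.≤ᵇ⇒≤ tt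

unexploitable-1 : Unexploitable 1ℚ 2ℚ
unexploitable-1 = ℚ.≤ᵇ⇒≤ tt , ℚ.≤ᵇ⇒≤ tt

shape : ∀ (r : RVec 3) → ThreeStrictSupp r ⊎ (r v3 ≡ 0 ⊎ (r v1 ≡ 0 × r v2 ≡ 0 × InSupp r v3))
shape r with r v3 ℕ.≟ 0 | r v1 ℕ.≟ 0 | r v2 ℕ.≟ 0
... | yes c≡0 | _       | _       = inj₂ (inj₁ c≡0)
... | no  c≢0 | no  a≢0 | _       = inj₁ (ℕ.n≢0⇒n>0 c≢0 , inj₁ (ℕ.n≢0⇒n>0 a≢0))
... | no  c≢0 | yes _   | no  b≢0 = inj₁ (ℕ.n≢0⇒n>0 c≢0 , inj₂ (ℕ.n≢0⇒n>0 b≢0))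
... | no  c≢0 | yes a≡0 | yes b≡0 = inj₂ (inj₂ (a≡0 , b≡0 , ℕ.n≢0⇒n>0 c≢0))

HalfOnThree : RStrat 3 → Set
HalfOnThree R = ∀ r → ThreeStrictSupp r → RStrat.prob R r v3 ≡ ½

counter : ∀ {p} → Dec (p ≤ ½) → Fin 3
counter (yes _) = v1
counter (no  _) = v2

bestResponse : RStrat 3 → RVec 3 → Fin 3
bestResponse R r = counter (RStrat.prob R r v3 ℚ.≤? ½)

module _ (R : RStrat 3) where
  open RStrat R

  lookahead-v1 : ∀ r → NonZeroR r → lookahead P3 R value r v1 ≡ value r + (½ - prob r v3) * gapAt r
  lookahead-v1 r nz = trans (payoffAgainst-supp-cong P3 R r (value∘dec r) v1)
                            (payoff₁-local (prob r) (value r) (gapAt r) (sum-one r nz))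

  lookahead-v2 : ∀ r → NonZeroR r → lookahead P3 R value r v2 ≡ value r + (prob r v3 - ½) * (2ℚ - gapAt r)
  lookahead-v2 r nz = trans (payoffAgainst-supp-cong P3 R r (value∘dec r) v2)
                            (payoff₂-local (prob r) (value r) (gapAt r) (sum-one r nz))

  lookahead-v3≤v1 : ∀ r → lookahead P3 R value r v3 ≤ lookahead P3 R value r v1
  lookahead-v3≤v1 r = payoffAgainst-dominated P3 (value ∘ dec r) {v1} {v3} (nonneg r) v1-dominates-v3

  value≤lookahead-counter : ∀ r → NonZeroR r → (d : Dec (prob r v3 ≤ ½)) →
                            value r ≤ lookahead P3 R value r (counter d)
  value≤lookahead-counter r nz (yes p≤½) = subst (value r ≤_) (sym (lookahead-v1 r nz))
    (p≤p+q (value r) (*-nonNeg (p≤q⇒0≤q-p p≤½) (proj₁ (gap-bounds (r v1 +ℕ r v2) (r v3)))))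
  value≤lookahead-counter r nz (no  p≰½) = subst (value r ≤_) (sym (lookahead-v2 r nz))
    (p≤p+q (value r) (*-nonNeg (p≤q⇒0≤q-p (ℚ.<⇒≤ (ℚ.≰⇒> p≰½))) (p≤q⇒0≤q-p γ≤2)))
    where γ≤2 = proj₂ (gap-bounds (r v1 +ℕ r v2) (r v3))

  value<lookahead-counter : ∀ r → ThreeStrictSupp r → prob r v3 ≢ ½ → (d : Dec (prob r v3 ≤ ½)) →
                            value r < lookahead P3 R value r (counter d)
  value<lookahead-counter r (c>0 , ab>0) p≢½ (yes p≤½) =
    subst (value r <_) (sym (lookahead-v1 r (v3 , c>0)))
      (p<p+q (value r) (*-pos (p<q⇒0<q-p (≤∧≢⇒< p≤½ p≢½)) (proj₁ (gap-strict c>0 ab>0))))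
  value<lookahead-counter r (c>0 , ab>0) p≢½ (no  p≰½) =
    subst (value r <_) (sym (lookahead-v2 r (v3 , c>0)))
      (p<p+q (value r) (*-pos (p<q⇒0<q-p (ℚ.≰⇒> p≰½)) (p<q⇒0<q-p (proj₂ (gap-strict c>0 ab>0)))))

  prob₃-only₃ : ∀ r → NonZeroR r → r v1 ≡ 0 → r v2 ≡ 0 → prob r v3 ≡ 1ℚ
  prob₃-only₃ r nz a≡0 b≡0 = only₃ (supported r v1 a≡0) (supported r v2 b≡0) (sum-one r nz)
    where
    only₃ : ∀ {p₁ p₂ p₃} → p₁ ≡ 0ℚ → p₂ ≡ 0ℚ → p₁ + (p₂ + (p₃ + 0ℚ)) ≡ 1ℚ → p₃ ≡ 1ℚ
    only₃ {p₃ = p₃} refl refl = trans (solve 1 (λ p → p := con 0ℚ :+ (con 0ℚ :+ (p :+ con 0ℚ))) refl p₃)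

  unexploitable : HalfOnThree R → ∀ r → NonZeroR r → Unexploitable (prob r v3) (gapAt r)
  unexploitable half r nz with shape r
  ... | inj₁ strict                   = subst (λ p → Unexploitable p (gapAt r)) (sym (half r strict))
                                              (unexploitable-½ (gapAt r))
  ... | inj₂ (inj₁ c≡0)               = subst₂ Unexploitable (sym (supported r v3 c≡0)) (sym (gap-no₃ c≡0))
                                               unexploitable-0
  ... | inj₂ (inj₂ (a≡0 , b≡0 , c>0)) = subst₂ Unexploitable (sym (prob₃-only₃ r nz a≡0 b≡0))
                                               (sym (gap-only₃ a≡0 b≡0 c>0)) unexploitable-1

  lookahead≤value : HalfOnThree R → ∀ r x → NonZeroR r → lookahead P3 R value r x ≤ value r
  lookahead≤value half r zero nz =
    subst (_≤ value r) (sym (lookahead-v1 r nz)) (p+q≤p (value r) (proj₁ (unexploitable half r nz)))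
  lookahead≤value half r (suc zero) nz =
    subst (_≤ value r) (sym (lookahead-v2 r nz)) (p+q≤p (value r) (proj₂ (unexploitable half r nz)))
  lookahead≤value half r (suc (suc zero)) nz =
    ℚ.≤-trans (lookahead-v3≤v1 r) (lookahead≤value half r zero nz)

  score≤value : HalfOnThree R → ∀ N r → score P3 r N R ≤ value r
  score≤value half = score≤ P3 R value value-empty (lookahead≤value half)

  value≤lookahead-best : ∀ r → NonZeroR r → value r ≤ lookahead P3 R value r (bestResponse R r)
  value≤lookahead-best r nz = value≤lookahead-counter r nz (prob r v3 ℚ.≤? ½)

  value≤score-best : ∀ r → value r ≤ score P3 r (pure (bestResponse R)) R
  value≤score-best = W≤score-pure P3 R value value-empty (bestResponse R) value≤lookahead-best

  value<score-best : ∀ r → ThreeStrictSupp r → prob r v3 ≢ ½ →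
                     value r < score P3 r (pure (bestResponse R)) R
  value<score-best r strict p≢½ =
    W<score-pure P3 R value value-empty (bestResponse R) value≤lookahead-best r (v3 , proj₁ strict)
      (value<lookahead-counter r strict p≢½ (prob r v3 ℚ.≤? ½))

halfStrategyAt : ℕ → ℕ → ℕ → Fin 3 → ℚ
halfStrategyAt zero    zero    zero    = 0ℚ ∷ 0ℚ ∷ 0ℚ ∷ []
halfStrategyAt (suc _) _       zero    = 1ℚ ∷ 0ℚ ∷ 0ℚ ∷ []
halfStrategyAt zero    (suc _) zero    = 0ℚ ∷ 1ℚ ∷ 0ℚ ∷ []
halfStrategyAt zero    zero    (suc _) = 0ℚ ∷ 0ℚ ∷ 1ℚ ∷ []
halfStrategyAt (suc _) _       (suc _) = ½  ∷ 0ℚ ∷ ½  ∷ []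
halfStrategyAt zero    (suc _) (suc _) = 0ℚ ∷ ½  ∷ ½  ∷ []

nonNeg-by-decision : ∀ {xs : Fin 3 → ℚ} {_ : True (all (0ℚ ℚ.≤?_) xs)} → All (0ℚ ≤_) xs
nonNeg-by-decision {_} {t} = toWitness t

halfStrategyAt-nonNeg : ∀ a b c → All (0ℚ ≤_) (halfStrategyAt a b c)
halfStrategyAt-nonNeg zero    zero    zero    = nonNeg-by-decision
halfStrategyAt-nonNeg (suc _) _       zero    = nonNeg-by-decision
halfStrategyAt-nonNeg zero    (suc _) zero    = nonNeg-by-decision
halfStrategyAt-nonNeg zero    zero    (suc _) = nonNeg-by-decision
halfStrategyAt-nonNeg (suc _) _       (suc _) = nonNeg-by-decision
halfStrategyAt-nonNeg zero    (suc _) (suc _) = nonNeg-by-decision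

halfStrategyAt-sum : ∀ a b c {k} → a +ℕ (b +ℕ (c +ℕ 0)) ≡ suc k → sumℚ 3 (halfStrategyAt a b c) ≡ 1ℚ
halfStrategyAt-sum zero    zero    zero    ()
halfStrategyAt-sum (suc _) _       zero    _ = refl
halfStrategyAt-sum zero    (suc _) zero    _ = refl
halfStrategyAt-sum zero    zero    (suc _) _ = refl
halfStrategyAt-sum (suc _) _       (suc _) _ = refl
halfStrategyAt-sum zero    (suc _) (suc _) _ = refl

halfStrategyAt-supported₁ : ∀ {a} b c → a ≡ 0 → halfStrategyAt a b c v1 ≡ 0ℚ
halfStrategyAt-supported₁ zero    zero    refl = refl
halfStrategyAt-supported₁ (suc _) zero    refl = refl
halfStrategyAt-supported₁ zero    (suc _) refl = refl
halfStrategyAt-supported₁ (suc _) (suc _) refl = refl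

halfStrategyAt-supported₂ : ∀ a {b} c → b ≡ 0 → halfStrategyAt a b c v2 ≡ 0ℚ
halfStrategyAt-supported₂ zero    zero    refl = refl
halfStrategyAt-supported₂ (suc _) zero    refl = refl
halfStrategyAt-supported₂ zero    (suc _) refl = refl
halfStrategyAt-supported₂ (suc _) (suc _) refl = refl

halfStrategyAt-supported₃ : ∀ a b {c} → c ≡ 0 → halfStrategyAt a b c v3 ≡ 0ℚ
halfStrategyAt-supported₃ zero    zero    refl = refl
halfStrategyAt-supported₃ (suc _) _       refl = refl
halfStrategyAt-supported₃ zero    (suc _) refl = refl

halfStrategyAt-half : ∀ {a b c} → 0 <ℕ c → 0 <ℕ a ⊎ 0 <ℕ b → halfStrategyAt a b c v3 ≡ ½
halfStrategyAt-half {suc _} {_}     {suc _} _ _         = refl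
halfStrategyAt-half {zero}  {suc _} {suc _} _ _         = refl
halfStrategyAt-half {zero}  {zero}  {suc _} _ (inj₁ ())
halfStrategyAt-half {zero}  {zero}  {suc _} _ (inj₂ ())

halfStrategy : RStrat 3
halfStrategy = record
  { prob      = λ r → halfStrategyAt (r v1) (r v2) (r v3)
  ; nonneg    = λ r → halfStrategyAt-nonNeg (r v1) (r v2) (r v3)
  ; supported = supported
  ; sum-one   = λ { r (_ , 0<rᵥ) → halfStrategyAt-sum (r v1) (r v2) (r v3) (total-dec r 0<rᵥ) }
  }
  where
  supported : ∀ r v → r v ≡ 0 → halfStrategyAt (r v1) (r v2) (r v3) v ≡ 0ℚ
  supported r zero             = halfStrategyAt-supported₁ (r v2) (r v3)
  supported r (suc zero)       = halfStrategyAt-supported₂ (r v1) (r v3)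
  supported r (suc (suc zero)) = halfStrategyAt-supported₃ (r v1) (r v2)

halfStrategy-halfOnThree : HalfOnThree halfStrategy
halfStrategy-halfOnThree r (c>0 , ab>0) = halfStrategyAt-half c>0 ab>0

isScoreR-value : ∀ R → HalfOnThree R → ∀ r → IsScoreR P3 r R (value r)
isScoreR-value R half r =
  isScoreR-intro P3 {r} (λ N → score≤value R half N r) (pure (bestResponse R)) (value≤score-best R r)

isValue-value : ∀ r → IsValue P3 r (value r)
isValue-value r = isValue-intro P3 {r} (λ R → pure (bestResponse R) , value≤score-best R r)
  halfStrategy (isScoreR-value halfStrategy halfStrategy-halfOnThree r)

attains-value⇒halfOnThree : ∀ R → (∀ r → IsScoreR P3 r R (value r)) → HalfOnThree R
attains-value⇒halfOnThree R attains r strict = decidable-stable (RStrat.prob R r v3 ℚ.≟ ½) λ p≢½ →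
  ℚ.<-irrefl refl
    (ℚ.<-≤-trans (value<score-best R r strict p≢½) (proj₁ (attains r) (pure (bestResponse R))))

theorem2p4 : (R : RStrat 3) →
    Optimal P3 R ⇔ (∀ r → ThreeStrictSupp r → RStrat.prob R r v3 ≡ ½)
theorem2p4 R = mk⇔ (attains-value⇒halfOnThree R) (isScoreR-value R) ⇔-∘ optimal⇔attains P3 isValue-value R
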